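{- Let $\mathcal{L}$ be a choice logic and let $m$ be a degree obtainable in $\mathcal{L}$. Then there is an $\mathcal{L}$-formula $F$ such that $\deg_{\mathcal{L}}(\mathcal{I},F)=m$ for every interpretation $\mathcal{I}$.
   Context: Let $\mathcal{U}$ be an infinite set of propositional variables; an interpretation is a set $\mathcal{I}\subseteq\mathcal{U}$. Write $\overline{\mathbb{N}}=\mathbb{N}\cup\{\infty\}$. A choice logic $\mathcal{L}$ is given by a finite set $C_{\mathcal{L}}$ of binary connective symbols disjoint from $\{\neg,\wedge,\vee\}$ and for each $\circ\in C_{\mathcal{L}}$ functions $\mathrm{opt}_\circ:\mathbb{N}^2\to\mathbb{N}$ with $\mathrm{opt}_\circ(k,\ell)\le(k+1)(\ell+1)$ and $\deg_\circ:\mathbb{N}^2\times\overline{\mathbb{N}}^2\to\overline{\mathbb{N}}$ with $\deg_\circ(k,\ell,m,n)\le\mathrm{opt}_\circ(k,\ell)$ or $=\infty$. Formulas: variables, $(\neg F)$, $(F\circ G)$ for $\circ\in\{\wedge,\vee\}\cup C_{\mathcal{L}}$. $\mathrm{opt}_{\mathcal{L}}(a)=\mathrm{opt}_{\mathcal{L}}(\neg F)=1$; $\mathrm{opt}_{\mathcal{L}}(F\wedge G)=\mathrm{opt}_{\mathcal{L}}(F\vee G)=\max(\mathrm{opt}_{\mathcal{L}}(F),\mathrm{opt}_{\mathcal{L}}(G))$; $\mathrm{opt}_{\mathcal{L}}(F\circ G)=\mathrm{opt}_\circ(\mathrm{opt}_{\mathcal{L}}(F),\mathrm{opt}_{\mathcal{L}}(G))$.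 $\deg_{\mathcal{L}}(\mathcal{I},a)=1$ if $a\in\mathcal{I}$ else $\infty$; $\deg_{\mathcal{L}}(\mathcal{I},\neg F)=1$ if $\deg_{\mathcal{L}}(\mathcal{I},F)=\infty$ else $\infty$; $\wedge$: max, $\vee$: min of operand degrees; $\deg_{\mathcal{L}}(\mathcal{I},F\circ G)=\deg_\circ(\mathrm{opt}_{\mathcal{L}}(F),\mathrm{opt}_{\mathcal{L}}(G),\deg_{\mathcal{L}}(\mathcal{I},F),\deg_{\mathcal{L}}(\mathcal{I},G))$. A degree $m\in\overline{\mathbb{N}}$ is obtainable in $\mathcal{L}$ if $\deg_{\mathcal{L}}(\mathcal{J},G)=m$ for some interpretation $\mathcal{J}$ and some $\mathcal{L}$-formula $G$. -}

module Defs where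

open import Data.Nat using (ℕ; suc; _*_; _≤_; _⊔_; _⊓_)
open import Data.Fin using (Fin)
open import Data.Bool using (Bool; true; false)
open import Data.Product using (Σ; _×_; ∃-syntax)
open import Data.Sum using (_⊎_)
open import Relation.Binary.PropositionalEquality using (_≡_)

data ℕ∞ : Set where
  fin : ℕ → ℕ∞
  ∞   : ℕ∞

max∞ : ℕ∞ → ℕ∞ → ℕ∞
max∞ ∞ _ = ∞
max∞ (fin _) ∞ = ∞
max∞ (fin a) (fin b) = fin (a ⊔ b)

min∞ : ℕ∞ → ℕ∞ → ℕ∞
min∞ ∞ y = y
min∞ (fin a) ∞ = fin a
min∞ (fin a) (fin b) = fin (a ⊓ b)

Var : Set
Var = ℕ

Interpretation : Set
Interpretation = Var → Bool

record ChoiceLogic : Set where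
  field
    k       : ℕ
    optC    : Fin k → ℕ → ℕ → ℕ
    optC-bound : ∀ c a b → optC c a b ≤ suc a * suc b
    degC    : Fin k → ℕ → ℕ → ℕ∞ → ℕ∞ → ℕ∞
    degC-bound : ∀ c a b m n →
      (degC c a b m n ≡ ∞) ⊎ (∃[ d ] (degC c a b m n ≡ fin d × d ≤ optC c a b))

module _ (L : ChoiceLogic) where
  open ChoiceLogic L

  data Formula : Set where
    var  : Var → Formula
    ¬'_  : Formula → Formula
    _∧'_ : Formula → Formula → Formula
    _∨'_ : Formula → Formula → Formula
    conn : Fin k → Formula → Formula → Formula

  optL : Formula → ℕ
  optL (var _) = 1
  optL (¬' _) = 1
  optL (F ∧' G) = optL F ⊔ optL G
  optL (F ∨' G) = optL F ⊔ optL G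
  optL (conn c F G) = optC c (optL F) (optL G)

  degL : Interpretation → Formula → ℕ∞
  degL I (var a) with I a
  ... | true = fin 1
  ... | false = ∞
  degL I (¬' F) with degL I F
  ... | ∞ = fin 1
  ... | fin _ = ∞
  degL I (F ∧' G) = max∞ (degL I F) (degL I G)
  degL I (F ∨' G) = min∞ (degL I F) (degL I G)
  degL I (conn c F G) = degC c (optL F) (optL G) (degL I F) (degL I G)

  Obtainable : ℕ∞ → Set
  Obtainable m = Σ Interpretation λ J → Σ Formula λ G → degL J G ≡ m

-- Replace every variable a of a formula G by a constant formula: the tautology
-- a ∨ ¬a if a ∈ J, the contradiction a ∧ ¬a otherwise.  Both have opt 1 and
-- the degree that a has under J, so by induction on G the substituted formula
-- has the same opt as G and, under every interpretation, the degree of G under J.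
module Submission where

open import Defs
open import Data.Product using (Σ; _,_)
open import Data.Nat using (_⊔_)
open import Data.Bool using (Bool; true; false)
open import Relation.Binary.PropositionalEquality using (_≡_; refl; cong₂; trans)

module _ (L : ChoiceLogic) where
  open ChoiceLogic L

  tautology : Var → Formula L
  tautology a = var a ∨' (¬' var a)

  contradiction : Var → Formula L
  contradiction a = var a ∧' (¬' var a)

  degL-tautology : ∀ I a → degL L I (tautology a) ≡ fin 1
  degL-tautology I a with I a
  ... | true  = refl
  ... | false = refl

  degL-contradiction : ∀ I a → degL L I (contradiction a) ≡ ∞
  degL-contradiction I a with I a
  ... | true  = refl
  ... | false = refl

  constVar : Var → Bool → Formula L
  constVar a true  = tautology a
  constVar a false = contradiction a

  optL-constVar : ∀ a b → optL L (constVar a b) ≡ 1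
  optL-constVar a true  = refl
  optL-constVar a false = refl

  degL-constVar : ∀ I J a → degL L I (constVar a (J a)) ≡ degL L J (var a)
  degL-constVar I J a with J a
  ... | true  = degL-tautology I a
  ... | false = degL-contradiction I a

  degL-¬-cong : ∀ I J F G → degL L I F ≡ degL L J G → degL L I (¬' F) ≡ degL L J (¬' G)
  degL-¬-cong I J F G eq with degL L I F | degL L J G
  degL-¬-cong I J F G refl | fin _ | fin _ = refl
  degL-¬-cong I J F G refl | ∞     | ∞     = refl

  freeze : Interpretation → Formula L → Formula L
  freeze J (var a)      = constVar a (J a)
  freeze J (¬' F)       = ¬' freeze J F
  freeze J (F ∧' G)     = freeze J F ∧' freeze J G
  freeze J (F ∨' G)     = freeze J F ∨' freeze J G
  freeze J (conn c F G) = conn c (freeze J F) (freeze J G)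

  optL-freeze : ∀ J F → optL L (freeze J F) ≡ optL L F
  optL-freeze J (var a)      = optL-constVar a (J a)
  optL-freeze J (¬' F)       = refl
  optL-freeze J (F ∧' G)     = cong₂ _⊔_ (optL-freeze J F) (optL-freeze J G)
  optL-freeze J (F ∨' G)     = cong₂ _⊔_ (optL-freeze J F) (optL-freeze J G)
  optL-freeze J (conn c F G) = cong₂ (optC c) (optL-freeze J F) (optL-freeze J G)

  degL-freeze : ∀ I J F → degL L I (freeze J F) ≡ degL L J F
  degL-freeze I J (var a)      = degL-constVar I J a
  degL-freeze I J (¬' F)       = degL-¬-cong I J (freeze J F) F (degL-freeze I J F)
  degL-freeze I J (F ∧' G)     = cong₂ max∞ (degL-freeze I J F) (degL-freeze I J G)
  degL-freeze I J (F ∨' G)     = cong₂ min∞ (degL-freeze I J F) (degL-freeze I J G)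
  degL-freeze I J (conn c F G)
    rewrite optL-freeze J F | optL-freeze J G | degL-freeze I J F | degL-freeze I J G = refl

lemma3 : (L : ChoiceLogic) (m : ℕ∞) → Obtainable L m →
    Σ (Formula L) λ F → (I : Interpretation) → degL L I F ≡ m
lemma3 L m (J , G , degJG≡m) = freeze L J G , λ I → trans (degL-freeze L I J G) degJG≡m
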